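{- Let $\pi=(\kappa,d)$ be a cyclic derivation in $\mathrm{i}\mathsf{K4}_{\mathrm{Seq}}$ (with the $\mathrm{i}\mathsf{K4}_{\mathrm{circ}}$ progress condition) whose root sequent is $\Gamma\Rightarrow\phi$. For each assumption $a$ of $\pi$ let $S_a$ be the sequent at $a$. Then $$\vdash_{\mathrm{i}\mathsf{GL}}\ \bigwedge\{S_a^{\#}\wedge\Box S_a^{\#} \mid a\text{ a non-boxed assumption of }\pi\}\ \wedge\ \bigwedge\{\Box S_a^{\#}\mid a\text{ a boxed assumption of }\pi\}\ \to\ (\Gamma\Rightarrow\phi)^{\#}.$$
   Context: Formulas are built from propositional variables and $\bot$ with $\to,\wedge,\vee,\Box$; a sequent $\Gamma\Rightarrow\phi$ is a finite multiset $\Gamma$ of formulas and one formula $\phi$; $\Box\Gamma=\{\Box\psi:\psi\in\Gamma\}$. For a sequent, $(\Gamma\Rightarrow\phi)^{\#}$ is the formula $\bigwedge\Gamma\to\phi$ (empty conjunctions are read as a tautology). $\mathrm{i}\mathsf{GL}$ is the smallest set of formulas containing all intuitionistic propositional tautologies, all formulas $\Box(\phi\to\psi)\to(\Box\phi\to\Box\psi)$ and $\Box(\Box\phi\to\phi)\to\Box\phi$, and closed under modus ponens and necessitation ($\phi/\Box\phi$); $\vdash_{\mathrm{i}\mathsf{GL}}\phi$ means $\phi\in\mathrm{i}\mathsf{GL}$. The rule set $\mathrm{i}\mathsf{K4}_{\mathrm{Seq}}$: Prop: $\Gamma,p\Rightarrow p$; Absurd: $\Gamma,\bot\Rightarrow\phi$;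 $(\wedge L)$: $\Gamma,\phi,\psi\Rightarrow\chi$ / $\Gamma,\phi\wedge\psi\Rightarrow\chi$; $(\wedge R)$: $\Gamma\Rightarrow\phi$, $\Gamma\Rightarrow\psi$ / $\Gamma\Rightarrow\phi\wedge\psi$; $(\vee L)$: $\Gamma,\phi\Rightarrow\chi$, $\Gamma,\psi\Rightarrow\chi$ / $\Gamma,\phi\vee\psi\Rightarrow\chi$; $(\vee R_0)$: $\Gamma\Rightarrow\phi$ / $\Gamma\Rightarrow\phi\vee\psi$; $(\vee R_1)$: $\Gamma\Rightarrow\psi$ / $\Gamma\Rightarrow\phi\vee\psi$; $(\to L)$: $\Gamma,\phi\to\psi\Rightarrow\phi$, $\Gamma,\psi\Rightarrow\chi$ / $\Gamma,\phi\to\psi\Rightarrow\chi$; $(\to R)$: $\Gamma,\phi\Rightarrow\psi$ / $\Gamma\Rightarrow\phi\to\psi$; $\mathrm{R}_{\mathsf{K4}}$: $\Gamma,\Box\Gamma\Rightarrow\phi$ / $\Pi,\Box\Gamma\Rightarrow\Box\phi$. A cyclic derivation in $\mathrm{i}\mathsf{K4}_{\mathrm{Seq}}$ (with the $\mathrm{i}\mathsf{K4}_{\mathrm{circ}}$ progress condition) is a pair $(\kappa,d)$ where $\kappa$ is a finite tree with node labels (sequent, rule name) in which each node is either an instance of a rule of $\mathrm{i}\mathsf{K4}_{\mathrm{Seq}}$ (with its children as premises) or a leaf with rule name "Assump", and $d$ (the backlink function) is a partial function from Assump-leaves to nodes such that for each $a\in\mathrm{dom}(d)$: $d(a)$ is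 a proper ancestor of $a$, $d(a)$ and $a$ carry the same sequent, and some node on the path from $d(a)$ (inclusive) to $a$ has rule name $\mathrm{R}_{\mathsf{K4}}$. The assumptions of $\pi$ are the Assump-leaves of $\kappa$ not in $\mathrm{dom}(d)$. An assumption $a$ is boxed if some proper ancestor of $a$ in $\kappa$ has rule name $\mathrm{R}_{\mathsf{K4}}$, and non-boxed otherwise. -}

module Defs where

open import Data.Nat using (ℕ; zero; suc)
open import Data.Bool using (Bool; true; false; _∨_)
open import Data.List using (List; []; _∷_; [_]; _++_; map)
open import Data.Maybe using (Maybe; just; nothing)
open import Data.Product using (Σ; ∃; _×_; _,_)
open import Data.List.Relation.Binary.Permutation.Propositional using (_↭_)
open import Data.List.Relation.Binary.Pointwise using (Pointwise)
open import Data.List.Relation.Unary.All using (All)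
open import Relation.Binary.PropositionalEquality using (_≡_)

infixr 25 □_
infixr 20 _∧'_
infixr 19 _∨'_
infixr 18 _⇒'_

data Fm : Set where
  var  : ℕ → Fm
  ⊥'   : Fm
  _⇒'_ : Fm → Fm → Fm
  _∧'_ : Fm → Fm → Fm
  _∨'_ : Fm → Fm → Fm
  □_   : Fm → Fm

⊤' : Fm
⊤' = ⊥' ⇒' ⊥'

⋀ : List Fm → Fm
⋀ []       = ⊤'
⋀ (φ ∷ []) = φ
⋀ (φ ∷ Γ)  = φ ∧' ⋀ Γ

□L : List Fm → List Fm
□L = map □_

-- iGL as a Hilbert system: intuitionistic propositional axioms
-- (whose closure under MP gives exactly all substitution instances of
-- intuitionistic tautologies in the modal language), K, Löb, MP, Nec.

data ⊢iGL : Fm → Set where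
  ax-K    : ∀ {φ ψ} → ⊢iGL (φ ⇒' ψ ⇒' φ)
  ax-S    : ∀ {φ ψ χ} → ⊢iGL ((φ ⇒' ψ ⇒' χ) ⇒' (φ ⇒' ψ) ⇒' φ ⇒' χ)
  ax-∧I   : ∀ {φ ψ} → ⊢iGL (φ ⇒' ψ ⇒' φ ∧' ψ)
  ax-∧E₁  : ∀ {φ ψ} → ⊢iGL (φ ∧' ψ ⇒' φ)
  ax-∧E₂  : ∀ {φ ψ} → ⊢iGL (φ ∧' ψ ⇒' ψ)
  ax-∨I₁  : ∀ {φ ψ} → ⊢iGL (φ ⇒' φ ∨' ψ)
  ax-∨I₂  : ∀ {φ ψ} → ⊢iGL (ψ ⇒' φ ∨' ψ)
  ax-∨E   : ∀ {φ ψ χ} → ⊢iGL ((φ ⇒' χ) ⇒' (ψ ⇒' χ) ⇒' φ ∨' ψ ⇒' χ)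
  ax-EFQ  : ∀ {φ} → ⊢iGL (⊥' ⇒' φ)
  ax-□K   : ∀ {φ ψ} → ⊢iGL (□ (φ ⇒' ψ) ⇒' □ φ ⇒' □ ψ)
  ax-Löb  : ∀ {φ} → ⊢iGL (□ (□ φ ⇒' φ) ⇒' □ φ)
  mp      : ∀ {φ ψ} → ⊢iGL (φ ⇒' ψ) → ⊢iGL φ → ⊢iGL ψ
  nec     : ∀ {φ} → ⊢iGL φ → ⊢iGL (□ φ)

-- Sequents (contexts are multisets, represented by lists up to ↭)

infix 4 _⊢_

record Sequent : Set where
  constructor _⊢_
  field
    ctx  : List Fm
    goal : Fm
open Sequent public

_# : Sequent → Fm
(Γ ⊢ φ) # = ⋀ Γ ⇒' φ

_≈S_ : Sequent → Sequent → Set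
(Γ ⊢ φ) ≈S (Δ ⊢ ψ) = (Γ ↭ Δ) × (φ ≡ ψ)

data RuleName : Set where
  Prop Absurd ∧L ∧R ∨L ∨R₀ ∨R₁ →L →R RK4 Assump : RuleName

data Canon : RuleName → Sequent → List Sequent → Set where
  c-Prop   : ∀ {Γ p} → Canon Prop (var p ∷ Γ ⊢ var p) []
  c-Absurd : ∀ {Γ φ} → Canon Absurd (⊥' ∷ Γ ⊢ φ) []
  c-∧L     : ∀ {Γ φ ψ χ} → Canon ∧L (φ ∧' ψ ∷ Γ ⊢ χ) [ φ ∷ ψ ∷ Γ ⊢ χ ]
  c-∧R     : ∀ {Γ φ ψ} → Canon ∧R (Γ ⊢ φ ∧' ψ) ((Γ ⊢ φ) ∷ (Γ ⊢ ψ) ∷ [])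
  c-∨L     : ∀ {Γ φ ψ χ} → Canon ∨L (φ ∨' ψ ∷ Γ ⊢ χ) ((φ ∷ Γ ⊢ χ) ∷ (ψ ∷ Γ ⊢ χ) ∷ [])
  c-∨R₀    : ∀ {Γ φ ψ} → Canon ∨R₀ (Γ ⊢ φ ∨' ψ) [ Γ ⊢ φ ]
  c-∨R₁    : ∀ {Γ φ ψ} → Canon ∨R₁ (Γ ⊢ φ ∨' ψ) [ Γ ⊢ ψ ]
  c-→L     : ∀ {Γ φ ψ χ} → Canon →L (φ ⇒' ψ ∷ Γ ⊢ χ)
                 ((φ ⇒' ψ ∷ Γ ⊢ φ) ∷ (ψ ∷ Γ ⊢ χ) ∷ [])
  c-→R     : ∀ {Γ φ ψ} → Canon →R (Γ ⊢ φ ⇒' ψ) [ φ ∷ Γ ⊢ ψ ]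
  c-RK4    : ∀ {Γ Π φ} → Canon RK4 (Π ++ □L Γ ⊢ □ φ) [ Γ ++ □L Γ ⊢ φ ]
  c-Assump : ∀ {S} → Canon Assump S []

RuleInst : RuleName → Sequent → List Sequent → Set
RuleInst r S Ss = ∃ λ S' → ∃ λ Ss' →
  Canon r S' Ss' × (S ≈S S') × Pointwise _≈S_ Ss Ss'

data Tree : Set where
  node : Sequent → RuleName → List Tree → Tree

seqOf : Tree → Sequent
seqOf (node S _ _) = S

ruleOf : Tree → RuleName
ruleOf (node _ r _) = r

data WF : Tree → Set where
  wf : ∀ {S r ts} → RuleInst r S (map seqOf ts) → All WF ts → WF (node S r ts)

Path : Set
Path = List ℕ

nth : List Tree → ℕ → Maybe Tree
nth []       _       = nothing
nth (t ∷ ts) zero    = just t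
nth (t ∷ ts) (suc n) = nth ts n

_at_ : Tree → Path → Maybe Tree
t at [] = just t
node _ _ ts at (i ∷ p) with nth ts i
... | nothing = nothing
... | just t' = t' at p

_≼_ : Path → Path → Set
b ≼ a = ∃ λ l → a ≡ b ++ l

_≺_ : Path → Path → Set
b ≺ a = ∃ λ i → ∃ λ l → a ≡ b ++ (i ∷ l)

-- backlink function d : partial map Assump-leaves → nodes
Backlink : Set
Backlink = Path → Maybe Path

BacklinkOK : Tree → Backlink → Set
BacklinkOK t d = ∀ a b → d a ≡ just b →
  (∃ λ S → t at a ≡ just (node S Assump [])) ×
  (b ≺ a) ×
  (∃ λ ta → ∃ λ tb → t at a ≡ just ta × t at b ≡ just tb × seqOf ta ≈S seqOf tb) ×
  (∃ λ c → b ≼ c × c ≼ a × ∃ λ tc → t at c ≡ just tc × ruleOf tc ≡ RK4)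

CyclicDerivation : Tree → Backlink → Set
CyclicDerivation t d = WF t × BacklinkOK t d

-- The antecedent: conjuncts for the assumptions (Assump leaves not in dom d),
-- S# ∧ □S# for non-boxed ones, □S# for boxed ones.  The Bool records whether
-- some proper ancestor of the current node is an RK4 node.

isRK4 : RuleName → Bool
isRK4 RK4 = true
isRK4 _   = false

ownFms : Bool → Sequent → RuleName → Maybe Path → List Fm
ownFms true  S Assump nothing = [ □ (S #) ]
ownFms false S Assump nothing = [ (S #) ∧' □ (S #) ]
ownFms _     _ _      _       = []

mutual
  assumpFms : Backlink → Bool → Path → Tree → List Fm
  assumpFms d bx p (node S r ts) = ownFms bx S r (d p) ++ childFms d (bx ∨ isRK4 r) p 0 ts

  childFms : Backlink → Bool → Path → ℕ → List Tree → List Fm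
  childFms d bx p i []       = []
  childFms d bx p i (t ∷ ts) = assumpFms d bx (p ++ [ i ]) t ++ childFms d bx p (suc i) ts

-- Löb induction along the tree.  At a node with sequent S we may assume □S#: the
-- hypotheses in play prove their own boxes, so Löb's rule discharges □S# again.
-- Crossing an R_K4 node boxes the whole context, so for its premise the sequents
-- S# of all ancestors are available unboxed; a backlinked leaf needs exactly that,
-- since the progress condition puts an R_K4 node between it and its companion.
-- Open assumptions are hypotheses: S#∧□S# and □S# both imply their own box (axiom 4
-- follows from Löb), and □S#, the form an assumption takes below an R_K4 node, still
-- proves □(S#∧□S#), so the premise of R_K4 may use the unboxed forms.
module Submission where

open import Defs
open import Data.Bool using (true; false)
open import Data.Nat using (ℕ; suc; _+_)
open import Data.Nat.Properties using (+-suc; +-identityʳ)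
open import Data.List using (List; []; _∷_; [_]; _++_; map)
open import Data.List.Properties
  using (++-identityʳ; ++-identityʳ-unique; ++-assoc; ∷-injective; ∷-injectiveʳ)
open import Data.Maybe using (Maybe; just; nothing)
open import Data.Maybe.Properties using (just-injective)
open import Data.Product using (∃; _×_; _,_)
open import Data.Sum using (_⊎_; inj₁; inj₂)
open import Data.Empty using (⊥-elim)
open import Function using (_∘_)
open import Data.List.Membership.Propositional using (_∈_)
open import Data.List.Relation.Unary.Any using (here; there)
open import Data.List.Relation.Unary.All as All using (All; []; _∷_)
import Data.List.Relation.Unary.All.Properties as Allₚ
open import Data.List.Relation.Binary.Pointwise using (Pointwise; []; _∷_)
open import Data.List.Relation.Binary.Permutation.Propositional using (↭-sym)
open import Data.List.Relation.Binary.Permutation.Propositional.Properties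
  using (∈-resp-↭; ++⁺ʳ)
open import Data.List.Relation.Binary.Subset.Propositional using (_⊆_)
open import Data.List.Relation.Binary.Subset.Propositional.Properties
  using (xs⊆xs++ys; xs⊆ys++xs; xs⊆x∷xs; ∷⁺ʳ)
open import Relation.Nullary using (¬_)
open import Relation.Binary.PropositionalEquality
  using (_≡_; _≢_; refl; sym; trans; cong; subst)

infix  3 _⊢GL_ _⊢*_ _⊢□_
infixl 6 _·_

data _⊢GL_ (Γ : List Fm) : Fm → Set where
  hyp : ∀ {φ} → φ ∈ Γ → Γ ⊢GL φ
  thm : ∀ {φ} → ⊢iGL φ → Γ ⊢GL φ
  _·_ : ∀ {φ ψ} → Γ ⊢GL φ ⇒' ψ → Γ ⊢GL φ → Γ ⊢GL ψ

_⊢*_ : List Fm → List Fm → Set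
Δ ⊢* Γ = All (Δ ⊢GL_) Γ

_⊢□_ : List Fm → List Fm → Set
Δ ⊢□ Γ = All (λ ψ → Δ ⊢GL □ ψ) Γ

⇒-id : ∀ {φ} → ⊢iGL (φ ⇒' φ)
⇒-id {φ} = mp (mp ax-S ax-K) (ax-K {φ} {φ})

closed : ∀ {φ} → [] ⊢GL φ → ⊢iGL φ
closed (hyp ())
closed (thm p) = p
closed (x · y) = mp (closed x) (closed y)

cut : ∀ {Γ Δ φ} → Δ ⊢* Γ → Γ ⊢GL φ → Δ ⊢GL φ
cut σ (hyp m) = All.lookup σ m
cut σ (thm p) = thm p
cut σ (x · y) = cut σ x · cut σ y

⊆⇒⊢* : ∀ {Γ Δ} → Γ ⊆ Δ → Δ ⊢* Γ
⊆⇒⊢* Γ⊆Δ = All.tabulate (hyp ∘ Γ⊆Δ)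

weaken : ∀ {Γ Δ φ} → Γ ⊆ Δ → Γ ⊢GL φ → Δ ⊢GL φ
weaken = cut ∘ ⊆⇒⊢*

⇒-intro : ∀ {Γ φ ψ} → φ ∷ Γ ⊢GL ψ → Γ ⊢GL φ ⇒' ψ
⇒-intro (hyp (here refl)) = thm ⇒-id
⇒-intro (hyp (there m))   = thm ax-K · hyp m
⇒-intro (thm p)           = thm ax-K · thm p
⇒-intro (x · y)           = thm ax-S · ⇒-intro x · ⇒-intro y

□-intro : ∀ {Γ Δ φ} → Γ ⊢GL φ → Δ ⊢□ Γ → Δ ⊢GL □ φ
□-intro (hyp m) σ = All.lookup σ m
□-intro (thm p) σ = thm (nec p)
□-intro (x · y) σ = thm ax-□K · □-intro x σ · □-intro y σ

∧-intro : ∀ {Γ φ ψ} → Γ ⊢GL φ → Γ ⊢GL ψ → Γ ⊢GL φ ∧' ψ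
∧-intro x y = thm ax-∧I · x · y

∧-elim₁ : ∀ {Γ φ ψ} → Γ ⊢GL φ ∧' ψ → Γ ⊢GL φ
∧-elim₁ x = thm ax-∧E₁ · x

∧-elim₂ : ∀ {Γ φ ψ} → Γ ⊢GL φ ∧' ψ → Γ ⊢GL ψ
∧-elim₂ x = thm ax-∧E₂ · x

hyp₀ : ∀ {Γ φ} → φ ∷ Γ ⊢GL φ
hyp₀ = hyp (here refl)

-- Löb's axiom applied to χ = φ ∧ □φ, which satisfies φ → (□χ → χ).
four : ∀ {φ} → ⊢iGL (□ φ ⇒' □ □ φ)
four {φ} = closed (⇒-intro (□-intro (∧-elim₂ hyp₀) (□χ ∷ [])))
  where
  χ = φ ∧' □ φ
  χ-progressive : [ φ ] ⊢GL □ χ ⇒' χ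
  χ-progressive =
    ⇒-intro (∧-intro (hyp (there (here refl))) (□-intro (∧-elim₁ hyp₀) (hyp₀ ∷ [])))
  □χ : [ □ φ ] ⊢GL □ χ
  □χ = thm ax-Löb · □-intro χ-progressive (hyp₀ ∷ [])

□⇒□[∧□] : ∀ {φ} → ⊢iGL (□ φ ⇒' □ (φ ∧' □ φ))
□⇒□[∧□] = closed (⇒-intro (□-intro φ∧□φ (hyp₀ ∷ thm four · hyp₀ ∷ [])))
  where
  φ∧□φ : ∀ {φ} → φ ∷ □ φ ∷ [] ⊢GL φ ∧' □ φ
  φ∧□φ = ∧-intro hyp₀ (hyp (there (here refl)))

⊢*-refl : ∀ {Γ} → Γ ⊢* Γ
⊢*-refl = ⊆⇒⊢* (λ m → m)

löb : ∀ {Γ φ} → Γ ⊢□ Γ → □ φ ∷ Γ ⊢GL φ → Γ ⊢GL φ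
löb Γ□ x = cut (□φ ∷ ⊢*-refl) x
  where □φ = thm ax-Löb · □-intro (⇒-intro x) Γ□

□-∷ : ∀ {Γ Δ φ} → Γ ⊢□ Δ → □ φ ∷ Γ ⊢□ φ ∷ Δ
□-∷ Δ□ = hyp₀ ∷ All.map (weaken there) Δ□

□-closed-∷ : ∀ {Γ φ} → Γ ⊢□ Γ → □ φ ∷ Γ ⊢□ □ φ ∷ Γ
□-closed-∷ Γ□ = thm four · hyp₀ ∷ All.map (weaken there) Γ□

Stable : Fm → Set
Stable φ = ⊢iGL (φ ⇒' □ φ)

stable⇒□-closed : ∀ {Γ} → All Stable Γ → Γ ⊢□ Γ
stable⇒□-closed st = All.tabulate (λ m → thm (All.lookup st m) · hyp m)

⋀-intro : ∀ {Γ Δ} → Γ ⊢* Δ → Γ ⊢GL ⋀ Δ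
⋀-intro []           = thm ⇒-id
⋀-intro (x ∷ [])     = x
⋀-intro (x ∷ y ∷ xs) = ∧-intro x (⋀-intro (y ∷ xs))

⋀-elim : ∀ {Γ} Δ → Γ ⊢GL ⋀ Δ → Γ ⊢* Δ
⋀-elim []          _ = []
⋀-elim (φ ∷ [])    x = x ∷ []
⋀-elim (φ ∷ ψ ∷ Δ) x = ∧-elim₁ x ∷ ⋀-elim (ψ ∷ Δ) (∧-elim₂ x)

curry-⋀ : ∀ {Γ} Δ {φ} → Δ ++ Γ ⊢GL φ → Γ ⊢GL ⋀ Δ ⇒' φ
curry-⋀ {Γ} Δ x = ⇒-intro (cut (Allₚ.++⁺ (⋀-elim Δ hyp₀) (⊆⇒⊢* there)) x)

uncurry-⋀ : ∀ {Γ} Δ {φ} → Γ ⊢GL ⋀ Δ ⇒' φ → Δ ++ Γ ⊢GL φ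
uncurry-⋀ {Γ} Δ x = weaken (xs⊆ys++xs Γ Δ) x · ⋀-intro (⊆⇒⊢* (xs⊆xs++ys Δ Γ))

#-resp-≈S : ∀ {Γ S S'} → S ≈S S' → Γ ⊢GL S' # → Γ ⊢GL S #
#-resp-≈S {Γ} {Δ ⊢ φ} {Δ' ⊢ .φ} (Δ↭Δ' , refl) x =
  curry-⋀ Δ (weaken (∈-resp-↭ (++⁺ʳ Γ (↭-sym Δ↭Δ'))) (uncurry-⋀ Δ' x))

≈S-sym : ∀ {S S'} → S ≈S S' → S' ≈S S
≈S-sym {Γ ⊢ φ} {Δ ⊢ .φ} (Γ↭Δ , refl) = ↭-sym Γ↭Δ , refl

≈S-resp-⊢* : ∀ {Γ Ss Ss'} → Pointwise _≈S_ Ss Ss' →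
             All (λ X → Γ ⊢GL X #) Ss → All (λ X → Γ ⊢GL X #) Ss'
≈S-resp-⊢* []         []       = []
≈S-resp-⊢* (S≈ ∷ Ss≈) (x ∷ xs) = #-resp-≈S (≈S-sym S≈) x ∷ ≈S-resp-⊢* Ss≈ xs

RK4-sound : ∀ {Γ Θ Π Δ φ} → Γ ⊢□ Θ →
            Θ ⊢GL ⋀ (Δ ++ □L Δ) ⇒' φ → Γ ⊢GL ⋀ (Π ++ □L Δ) ⇒' □ φ
RK4-sound {Γ} {Θ} {Π} {Δ} Θ□ x =
  curry-⋀ (Π ++ □L Δ)
    (□-intro (uncurry-⋀ (Δ ++ □L Δ) x) (Allₚ.++⁺ (Allₚ.++⁺ Δ□ □Δ□) Θ□′))
  where
  □Δ : (Π ++ □L Δ) ++ Γ ⊢* □L Δ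
  □Δ = ⊆⇒⊢* (xs⊆xs++ys (Π ++ □L Δ) Γ ∘ xs⊆ys++xs (□L Δ) Π)
  Δ□ : (Π ++ □L Δ) ++ Γ ⊢□ Δ
  Δ□ = Allₚ.map⁻ □Δ
  □Δ□ : (Π ++ □L Δ) ++ Γ ⊢□ □L Δ
  □Δ□ = Allₚ.map⁺ (All.map (thm four ·_) Δ□)
  Θ□′ : (Π ++ □L Δ) ++ Γ ⊢□ Θ
  Θ□′ = All.map (weaken (xs⊆ys++xs Γ (Π ++ □L Δ))) Θ□

data RuleShape : RuleName → Sequent → List Sequent → Set where
  propositional : ∀ {r S Ss} → isRK4 r ≡ false →
                  (∀ {Γ} → All (λ X → Γ ⊢GL X #) Ss → Γ ⊢GL S #) → RuleShape r S Ss
  modal         : ∀ {Π Δ φ} → RuleShape RK4 (Π ++ □L Δ ⊢ □ φ) [ Δ ++ □L Δ ⊢ φ ]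
  assumption    : ∀ {S} → RuleShape Assump S []

canon-shape : ∀ {r S Ss} → Canon r S Ss → RuleShape r S Ss
canon-shape (c-Prop {Γ = Δ} {p}) = propositional refl λ { [] → curry-⋀ (var p ∷ Δ) hyp₀ }
canon-shape (c-Absurd {Γ = Δ}) = propositional refl λ { [] →
  curry-⋀ (⊥' ∷ Δ) (thm ax-EFQ · hyp₀) }
canon-shape (c-∧L {Γ = Δ} {φ} {ψ}) = propositional refl λ { (x ∷ []) →
  curry-⋀ (φ ∧' ψ ∷ Δ)
    (cut (∧-elim₁ hyp₀ ∷ ∧-elim₂ hyp₀ ∷ ⊆⇒⊢* there) (uncurry-⋀ (φ ∷ ψ ∷ Δ) x)) }
canon-shape (c-∧R {Γ = Δ}) = propositional refl λ { (x ∷ y ∷ []) →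
  curry-⋀ Δ (∧-intro (uncurry-⋀ Δ x) (uncurry-⋀ Δ y)) }
canon-shape (c-∨L {Γ = Δ} {φ} {ψ}) = propositional refl λ { (x ∷ y ∷ []) →
  curry-⋀ (φ ∨' ψ ∷ Δ)
    (thm ax-∨E · case (uncurry-⋀ (φ ∷ Δ) x) · case (uncurry-⋀ (ψ ∷ Δ) y) · hyp₀) }
  where
  case : ∀ {Γ α β χ} → α ∷ Γ ⊢GL χ → β ∷ Γ ⊢GL α ⇒' χ
  case {Γ} {β = β} = ⇒-intro ∘ weaken (∷⁺ʳ _ (xs⊆x∷xs Γ β))
canon-shape (c-∨R₀ {Γ = Δ}) = propositional refl λ { (x ∷ []) →
  curry-⋀ Δ (thm ax-∨I₁ · uncurry-⋀ Δ x) }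
canon-shape (c-∨R₁ {Γ = Δ}) = propositional refl λ { (x ∷ []) →
  curry-⋀ Δ (thm ax-∨I₂ · uncurry-⋀ Δ x) }
canon-shape (c-→L {Γ = Δ} {φ} {ψ}) = propositional refl λ { (x ∷ y ∷ []) →
  curry-⋀ (φ ⇒' ψ ∷ Δ)
    (cut (hyp₀ · uncurry-⋀ (φ ⇒' ψ ∷ Δ) x ∷ ⊆⇒⊢* there) (uncurry-⋀ (ψ ∷ Δ) y)) }
canon-shape (c-→R {Γ = Δ} {φ}) = propositional refl λ { (x ∷ []) →
  curry-⋀ Δ (⇒-intro (uncurry-⋀ (φ ∷ Δ) x)) }
canon-shape (c-RK4 {Δ} {Π}) = modal {Π} {Δ}
canon-shape c-Assump = assumption

data OwnView : RuleName → Maybe Path → Set where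
  open-assumption : OwnView Assump nothing
  no-own          : ∀ {r m} → (∀ bx S → ownFms bx S r m ≡ []) → OwnView r m

ownView : ∀ r m → OwnView r m
ownView Assump nothing  = open-assumption
ownView Assump (just _) = no-own λ { true _ → refl ; false _ → refl }
ownView Prop   _        = no-own λ { true _ → refl ; false _ → refl }
ownView Absurd _        = no-own λ { true _ → refl ; false _ → refl }
ownView ∧L     _        = no-own λ { true _ → refl ; false _ → refl }
ownView ∧R     _        = no-own λ { true _ → refl ; false _ → refl }
ownView ∨L     _        = no-own λ { true _ → refl ; false _ → refl }
ownView ∨R₀    _        = no-own λ { true _ → refl ; false _ → refl }
ownView ∨R₁    _        = no-own λ { true _ → refl ; false _ → refl }
ownView →L     _        = no-own λ { true _ → refl ; false _ → refl }
ownView →R     _        = no-own λ { true _ → refl ; false _ → refl }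
ownView RK4    _        = no-own λ { true _ → refl ; false _ → refl }

ownFms-stable : ∀ bx S r m → All Stable (ownFms bx S r m)
ownFms-stable bx S r m with ownView r m
ownFms-stable true  S _ _ | open-assumption = four ∷ []
ownFms-stable false S _ _ | open-assumption =
  closed (⇒-intro (thm □⇒□[∧□] · ∧-elim₂ hyp₀)) ∷ []
ownFms-stable bx    S _ _ | no-own none rewrite none bx S = []

ownFms-boxed : ∀ {Γ} bx S r m → Γ ⊢* ownFms true S r m → Γ ⊢□ ownFms bx S r m
ownFms-boxed bx S r m σ with ownView r m
ownFms-boxed true  S _ _ (x ∷ []) | open-assumption = thm four · x ∷ []
ownFms-boxed false S _ _ (x ∷ []) | open-assumption = thm □⇒□[∧□] · x ∷ []
ownFms-boxed bx    S _ _ _        | no-own none rewrite none bx S = []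

mutual
  assumpFms-stable : ∀ d bx p s → All Stable (assumpFms d bx p s)
  assumpFms-stable d bx p (node S r ts) =
    Allₚ.++⁺ (ownFms-stable bx S r (d p)) (childFms-stable d _ p 0 ts)

  childFms-stable : ∀ d bx p k ts → All Stable (childFms d bx p k ts)
  childFms-stable d bx p k []       = []
  childFms-stable d bx p k (t ∷ ts) =
    Allₚ.++⁺ (assumpFms-stable d bx (p ++ [ k ]) t) (childFms-stable d bx p (suc k) ts)

mutual
  assumpFms-boxed : ∀ {Γ} d bx p s → Γ ⊢* assumpFms d true p s → Γ ⊢□ assumpFms d bx p s
  assumpFms-boxed d bx p (node S r ts) σ =
    Allₚ.++⁺ (ownFms-boxed bx S r (d p) (Allₚ.++⁻ˡ (ownFms true S r (d p)) σ))
             (childFms-boxed d _ p 0 ts (Allₚ.++⁻ʳ (ownFms true S r (d p)) σ))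

  childFms-boxed : ∀ {Γ} d bx p k ts → Γ ⊢* childFms d true p k ts → Γ ⊢□ childFms d bx p k ts
  childFms-boxed d bx p k []       σ = []
  childFms-boxed d bx p k (t ∷ ts) σ =
    Allₚ.++⁺ (assumpFms-boxed d bx (p ++ [ k ]) t (Allₚ.++⁻ˡ (assumpFms d true (p ++ [ k ]) t) σ))
             (childFms-boxed d bx p (suc k) ts (Allₚ.++⁻ʳ (assumpFms d true (p ++ [ k ]) t) σ))

≼⇒≡⊎≺ : ∀ {c p} → c ≼ p → c ≡ p ⊎ c ≺ p
≼⇒≡⊎≺ {c} ([]    , refl) = inj₁ (sym (++-identityʳ c))
≼⇒≡⊎≺     (i ∷ l , eq)   = inj₂ (i , l , eq)

≺⇒⋡ : ∀ {c p} → c ≺ p → ¬ p ≼ c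
≺⇒⋡ {c} (i , l , refl) (l' , eq) with ++-identityʳ-unique c (trans eq (++-assoc c (i ∷ l) l'))
... | ()

≺-[] : ∀ {c} → ¬ c ≺ []
≺-[] {[]}    (_ , _ , ())
≺-[] {_ ∷ _} (_ , _ , ())

≺-snoc⁻ : ∀ c p {i} → c ≺ (p ++ [ i ]) → c ≼ p
≺-snoc⁻ []      p       _            = p , refl
≺-snoc⁻ (x ∷ c) []      (j , l , eq) = ⊥-elim (≺-[] (j , l , ∷-injectiveʳ eq))
≺-snoc⁻ (x ∷ c) (y ∷ p) (j , l , eq) with refl , eq′ ← ∷-injective eq
                                     with l′ , refl ← ≺-snoc⁻ c p (j , l , eq′) = l′ , refl

at-++ : ∀ t p {s} q → t at p ≡ just s → t at (p ++ q) ≡ s at q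
at-++ t [] q refl = refl
at-++ (node S r ts) (i ∷ p) q eq with nth ts i
at-++ (node S r ts) (i ∷ p) q () | nothing
...                              | just t′ = at-++ t′ p q eq

at-child : ∀ t p {S r ts} i → t at p ≡ just (node S r ts) → t at (p ++ [ i ]) ≡ nth ts i
at-child t p {ts = ts} i eq rewrite at-++ t p [ i ] eq with nth ts i
... | nothing = refl
... | just _  = refl

just-unique : ∀ {A : Set} {m : Maybe A} {x y} → m ≡ just x → m ≡ just y → x ≡ y
just-unique eq eq′ = just-injective (trans (sym eq) eq′)

RK4≢ : ∀ {r} → isRK4 r ≡ false → r ≢ RK4
RK4≢ () refl

module Soundness (t : Tree) (d : Backlink) (bl : BacklinkOK t d) where

  RK4Between : Path → Path → Set
  RK4Between b p = ∃ λ c → b ≼ c × c ≺ p × ∃ λ tc → t at c ≡ just tc × ruleOf tc ≡ RK4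

  RK4-strictly-above : ∀ {p S r ts c tc} → t at p ≡ just (node S r ts) → r ≢ RK4 →
                       c ≼ p → t at c ≡ just tc → ruleOf tc ≡ RK4 → c ≺ p
  RK4-strictly-above atp r≢RK4 c≼p atc rk with ≼⇒≡⊎≺ c≼p
  ... | inj₂ c≺p  = c≺p
  ... | inj₁ refl = ⊥-elim (r≢RK4 (trans (cong ruleOf (just-unique atp atc)) rk))

  AncestorsIn : List Fm → Path → Set
  AncestorsIn Anc p = ∀ {b tb} → b ≺ p → t at b ≡ just tb → seqOf tb # ∈ Anc

  ancestorsIn-child : ∀ {Anc p s i} → t at p ≡ just s → AncestorsIn Anc p →
                      AncestorsIn (seqOf s # ∷ Anc) (p ++ [ i ])
  ancestorsIn-child {p = p} atp anc {b} b≺ atb with ≼⇒≡⊎≺ (≺-snoc⁻ b p b≺)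
  ... | inj₁ refl rewrite just-unique atp atb = here refl
  ... | inj₂ b≺p  = there (anc b≺p atb)

  record Ancestry (Γ Anc : List Fm) (p : Path) : Set where
    field
      ancestors∈ : AncestorsIn Anc p
      ancestors□ : Γ ⊢□ Anc
      guarded    : ∀ {b tb} → b ≺ p → t at b ≡ just tb → RK4Between b p → Γ ⊢GL seqOf tb #
  open Ancestry

  root-ancestry : ∀ {Γ} → Ancestry Γ [] []
  root-ancestry = record
    { ancestors∈ = λ b≺ _ → ⊥-elim (≺-[] b≺)
    ; ancestors□ = []
    ; guarded    = λ b≺ _ _ → ⊥-elim (≺-[] b≺)
    }

  ancestry-child : ∀ {Γ Anc p S r ts} → t at p ≡ just (node S r ts) → r ≢ RK4 →
                   Ancestry Γ Anc p → ∀ i → Ancestry (□ (S #) ∷ Γ) (S # ∷ Anc) (p ++ [ i ])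
  ancestry-child {Γ} {p = p} {S} atp r≢RK4 A i = record
    { ancestors∈ = ancestorsIn-child atp (ancestors∈ A)
    ; ancestors□ = □-∷ (ancestors□ A)
    ; guarded    = guarded-child
    }
    where
    guarded-child : ∀ {b tb} → b ≺ (p ++ [ i ]) → t at b ≡ just tb → RK4Between b (p ++ [ i ]) →
                    □ (S #) ∷ Γ ⊢GL seqOf tb #
    guarded-child {b} b≺ atb (c , b≼c , c≺ , tc , atc , rk)
      with c≺p ← RK4-strictly-above atp r≢RK4 (≺-snoc⁻ c p c≺) atc rk
      with ≼⇒≡⊎≺ (≺-snoc⁻ b p b≺)
    ... | inj₁ refl = ⊥-elim (≺⇒⋡ c≺p b≼c)
    ... | inj₂ b≺p  = weaken there (guarded A b≺p atb (c , b≼c , c≺p , tc , atc , rk))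

  ancestry-below-RK4 : ∀ {Θ Anc p s} → t at p ≡ just s → AncestorsIn Anc p →
                       Θ ⊢□ (seqOf s # ∷ Anc) → (seqOf s # ∷ Anc) ⊆ Θ →
                       ∀ i → Ancestry Θ (seqOf s # ∷ Anc) (p ++ [ i ])
  ancestry-below-RK4 atp anc Anc□ Anc⊆Θ i = record
    { ancestors∈ = ancestorsIn-child atp anc
    ; ancestors□ = Anc□
    ; guarded    = λ b≺ atb _ → hyp (Anc⊆Θ (ancestorsIn-child atp anc b≺ atb))
    }

  assumption-sound : ∀ {Γ Anc p S ts} → t at p ≡ just (node S Assump ts) → Ancestry Γ Anc p →
                     Γ ⊢* ownFms false S Assump (d p) → Γ ⊢GL S #
  assumption-sound {p = p} atp A σ with d p in dp
  ... | nothing = ∧-elim₁ (All.head σ)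
  ... | just b
    with _ , b≺p , (ta , tb , ata , atb , ta≈tb) , (c , b≼c , c≼p , tc , atc , rk) ← bl p b dp
    with refl ← just-unique atp ata
    = #-resp-≈S ta≈tb (guarded A b≺p atb (c , b≼c , c≺p , tc , atc , rk))
    where c≺p = RK4-strictly-above atp (λ ()) c≼p atc rk

  ChildrenAt : Path → ℕ → List Tree → Set
  ChildrenAt p k ts = ∀ j → t at (p ++ [ k + j ]) ≡ nth ts j

  childrenAt-head : ∀ p {k c ts} → ChildrenAt p k (c ∷ ts) → t at (p ++ [ k ]) ≡ just c
  childrenAt-head p {k} {c} pos = subst (λ i → t at (p ++ [ i ]) ≡ just c) (+-identityʳ k) (pos 0)

  childrenAt-tail : ∀ p {k c ts} → ChildrenAt p k (c ∷ ts) → ChildrenAt p (suc k) ts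
  childrenAt-tail p {k} {ts = ts} pos j =
    subst (λ i → t at (p ++ [ i ]) ≡ nth ts j) (+-suc k j) (pos (suc j))

  mutual
    sound : ∀ {Γ Anc} p {s} → t at p ≡ just s → WF s → Γ ⊢□ Γ → Ancestry Γ Anc p →
            Γ ⊢* assumpFms d false p s → Γ ⊢GL seqOf s #
    sound p {node S r ts} atp (wf (_ , _ , rule , S≈ , ts≈) wfs) Γ□ A σ with canon-shape rule
    ... | propositional notRK4 rule-sound =
      löb Γ□ (#-resp-≈S S≈ (rule-sound (≈S-resp-⊢* ts≈ (Allₚ.map⁺ premises))))
      where
      premises = premises-sound p atp notRK4 wfs Γ□ A (Allₚ.++⁻ʳ (ownFms false S r (d p)) σ)
    ... | modal {Π} {Δ} =
      löb Γ□ (#-resp-≈S S≈ (modal-sound p {Π = Π} {Δ} atp wfs Γ□ A (Allₚ.++⁻ʳ [] σ) ts≈))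
    ... | assumption = assumption-sound atp A (Allₚ.++⁻ˡ (ownFms false S Assump (d p)) σ)

    premises-sound : ∀ {Γ Anc} p {S r ts} → t at p ≡ just (node S r ts) → isRK4 r ≡ false →
                     All WF ts → Γ ⊢□ Γ → Ancestry Γ Anc p → Γ ⊢* childFms d (isRK4 r) p 0 ts →
                     All (λ c → □ (S #) ∷ Γ ⊢GL seqOf c #) ts
    premises-sound p {ts = ts} atp notRK4 wfs Γ□ A σ =
      children 0 ts (λ i → at-child t p i atp) wfs (□-closed-∷ Γ□)
        (ancestry-child atp (RK4≢ notRK4) A)
        (All.map (weaken there) (subst (λ bx → _ ⊢* childFms d bx p 0 ts) notRK4 σ))

    children : ∀ {Γ Anc p} k ts → ChildrenAt p k ts → All WF ts → Γ ⊢□ Γ →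
               (∀ i → Ancestry Γ Anc (p ++ [ i ])) → Γ ⊢* childFms d false p k ts →
               All (λ c → Γ ⊢GL seqOf c #) ts
    children k []       _  []       _  _ _ = []
    children {p = p} k (c ∷ ts) pos (w ∷ ws) Γ□ A σ =
      sound (p ++ [ k ]) (childrenAt-head p pos) w Γ□ (A k) (Allₚ.++⁻ˡ _ σ) ∷
      children (suc k) ts (childrenAt-tail p pos) ws Γ□ A (Allₚ.++⁻ʳ _ σ)

    modal-sound : ∀ {Γ Anc} p {S ts Π Δ φ} → t at p ≡ just (node S RK4 ts) → All WF ts →
                  Γ ⊢□ Γ → Ancestry Γ Anc p → Γ ⊢* childFms d true p 0 ts →
                  Pointwise _≈S_ (map seqOf ts) [ Δ ++ □L Δ ⊢ φ ] →
                  □ (S #) ∷ Γ ⊢GL ⋀ (Π ++ □L Δ) ⇒' □ φ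
    modal-sound {Γ} {Anc} p {S} {c ∷ []} {Π} {Δ} atp (w ∷ []) Γ□ A σ (c≈ ∷ []) =
      RK4-sound {Π = Π} {Δ} Θ□ (#-resp-≈S (≈S-sym c≈) premise)
      where
      Γ′ = □ (S #) ∷ Γ
      Anc′ = S # ∷ Anc
      X = assumpFms d false (p ++ [ 0 ]) c
      -- Everything whose box Γ′ proves may serve as a hypothesis of the premise; in
      -- particular the ancestors' sequents, which is what makes them guarded below.
      Θ = Γ′ ++ Anc′ ++ X
      Θ□ : Γ′ ⊢□ Θ
      Θ□ = Allₚ.++⁺ (□-closed-∷ Γ□) (Allₚ.++⁺ (□-∷ (ancestors□ A))
             (All.map (weaken there) (assumpFms-boxed d false (p ++ [ 0 ]) c (Allₚ.++⁻ˡ _ σ))))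
      Θ-closed : Θ ⊢□ Θ
      Θ-closed = All.map (weaken (xs⊆xs++ys Γ′ _)) Θ□
      Θ-ancestry : Ancestry Θ Anc′ (p ++ [ 0 ])
      Θ-ancestry = ancestry-below-RK4 atp (ancestors∈ A)
                     (All.map (weaken (xs⊆xs++ys Γ′ _)) (□-∷ (ancestors□ A)))
                     (xs⊆ys++xs (Anc′ ++ X) Γ′ ∘ xs⊆xs++ys Anc′ X) 0
      Θ⊢X : Θ ⊢* X
      Θ⊢X = ⊆⇒⊢* (xs⊆ys++xs (Anc′ ++ X) Γ′ ∘ xs⊆ys++xs X Anc′)
      premise : Θ ⊢GL seqOf c #
      premise = sound (p ++ [ 0 ]) (at-child t p 0 atp) w Θ-closed Θ-ancestry Θ⊢X

mainTheorem6 : (t : Tree) (d : Backlink) → CyclicDerivation t d →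
    ⊢iGL (⋀ (assumpFms d false [] t) ⇒' seqOf t #)
mainTheorem6 t d (wf-t , bl) = closed (curry-⋀ Γ₀ (weaken (xs⊆xs++ys Γ₀ []) root-sound))
  where
  open Soundness t d bl
  Γ₀ = assumpFms d false [] t
  root-sound : Γ₀ ⊢GL seqOf t #
  root-sound =
    sound [] refl wf-t (stable⇒□-closed (assumpFms-stable d false [] t)) root-ancestry ⊢*-refl
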